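{- Let $K$ be an algebraic extension of $\mathbb{Q}_2$ with discrete valuation, ring of integers $\mathcal{O}_K$, uniformizer $\pi$ and ramification index $e$. Let $a\in\mathcal{O}_K^\times$, $n\in\mathbb{N}$, $N\in\frac1e\mathbb{N}$ and $f\in\mathcal{O}_K[[t]]/(t^n)$. Assume that $\psi_{+,n}(f)\in\mathcal{O}_K[[t]]/(t^n)$. Then, when the algorithm $\mathtt{LinDiffSolve}(a,f,n)$ is run with fixed point arithmetic at precision $O(2^M)$ with $M=N+\lfloor\log_2(n+1)\rfloor+1$, all the performed computations are done in $\mathcal{O}_K$ (no division raises an error) and the result is correct at precision $O(2^N)$, i.e. it is congruent to $\psi_{+,n}(f)$ modulo $(\pi^{eN},t^n)$.
   Context: $\upsilon_2$ is the $2$-adic valuation normalized by $\upsilon_2(2)=1$. For $f\in K[[t]]$, $\psi_+(f)$ is the unique solution $y\in K[[t]]$ of $t(t-4a)y'+(t-2a)y=f$; it maps $t^nK[[t]]$ into itself, and $\psi_{+,n}$ denotes the induced $K$-linear endomorphism of $K[[t]]/(t^n)$. The algorithm $\mathtt{LinDiffSolve}(a,f,n)$, on input $f=\sum_{i=0}^{n-1}f_it^i$, sets $y_0:=-f_0/(2a)$ and then, for $i=1,\dots,n-1$, $y_i:=\dfrac{i\,y_{i-1}-f_i}{2a(2i+1)}$, and returns $\sum_{i=0}^{n-1}y_it^i$. Fixed point arithmetic at precision $O(2^M)$ ($M\in\frac1e\mathbb{Z}$): elements are $x+O(2^M)$ with $x\in\mathcal{O}_K/\pi^{eM}\mathcal{O}_K$;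 $+,-,\times$ are computed in $\mathcal{O}_K/\pi^{eM}\mathcal{O}_K$; division of $x+O(2^M)$ by $y+O(2^M)$ raises an error if $\upsilon_2(y)>\upsilon_2(x)$, returns $0+O(2^M)$ if $x=0$, and otherwise returns some $z+O(2^M)$ with $x=yz$ in $\mathcal{O}_K/\pi^{eM}\mathcal{O}_K$ (the valuation of an element of the quotient is $M$ if it is zero and the valuation of any lift otherwise). -}

module Defs where

open import Level using (Level; _⊔_) renaming (suc to lsuc)
open import Algebra.Bundles using (CommutativeRing)
open import Data.Nat as ℕ using (ℕ; zero; suc; _≤_; _<_)
open import Data.Nat.Logarithm using (⌊log₂_⌋)
open import Data.Product using (Σ; ∃; _×_; _,_)
open import Data.Sum using (_⊎_)
open import Relation.Nullary using (¬_)

module RingNotation {c ℓ} (R : CommutativeRing c ℓ) where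
  open CommutativeRing R

  pow : Carrier → ℕ → Carrier
  pow x zero    = 1#
  pow x (suc k) = x * pow x k

  ι : ℕ → Carrier
  ι zero    = 0#
  ι (suc k) = 1# + ι k

  IsUnit : Carrier → Set (c ⊔ ℓ)
  IsUnit u = Σ Carrier λ v → u * v ≈ 1#

  Divides : Carrier → Carrier → Set (c ⊔ ℓ)
  Divides x y = Σ Carrier λ q → y ≈ x * q

-- The ring of integers O_K of a discretely valued field K of
-- characteristic 0 whose residue characteristic is 2: a discrete
-- valuation ring with uniformizer π and absolute ramification index
-- e = v_π(2) ≥ 1.

record DVR₂ (c ℓ : Level) : Set (lsuc (c ⊔ ℓ)) where
  field
    cring : CommutativeRing c ℓ
  open CommutativeRing cring public
  open RingNotation cring public
  field
    1≉0       : ¬ (1# ≈ 0#)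
    domain    : ∀ x y → x * y ≈ 0# → (x ≈ 0#) ⊎ (y ≈ 0#)
    π         : Carrier
    π≉0       : ¬ (π ≈ 0#)
    π-nonunit : ¬ IsUnit π
    factor    : ∀ x → ¬ (x ≈ 0#) → Σ ℕ λ k → Σ Carrier λ u → IsUnit u × (x ≈ u * pow π k)
    e         : ℕ
    e≥1       : 1 ≤ e
    two       : Σ Carrier λ u → IsUnit u × (ι 2 ≈ u * pow π e)

module OnDVR {c ℓ} (O : DVR₂ c ℓ) where
  open DVR₂ O

  Cong : ℕ → Carrier → Carrier → Set (c ⊔ ℓ)
  Cong m x y = Divides (pow π m) (x - y)

  -- Truncated power series: ℕ → O, only coefficients of index < n matter.

  Series : Set c
  Series = ℕ → Carrier

  mulT : Series → Series
  mulT g ℕ.zero    = 0#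
  mulT g (suc i) = g i

  deriv : Series → Series
  deriv g i = ι (suc i) * g (suc i)

  scale : Carrier → Series → Series
  scale λ' g i = λ' * g i

  _⊕_ : Series → Series → Series
  (g ⊕ h) i = g i + h i

  _⊖_ : Series → Series → Series
  (g ⊖ h) i = g i - h i

  Lop : Carrier → Series → Series
  Lop a y = mulT (mulT (deriv y) ⊖ scale (ι 4 * a) (deriv y))
            ⊕ (mulT y ⊖ scale (ι 2 * a) y)

  -- y represents ψ_{+,n}(f) (with integral coefficients):
  -- t(t-4a)y' + (t-2a)y ≡ f  (mod t^n), coefficients in O_K.
  IsPsi : Carrier → ℕ → Series → Series → Set ℓ
  IsPsi a n f y = ∀ i → i < n → Lop a y i ≈ f i

  -- Fixed point arithmetic at precision O(2^M); we write m = e·M ∈ ℕ,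
  -- so elements of O_K/π^m are represented by lifts in O_K.

  -- Truncated valuation  w(x) = min(υ_π(x), m)  (υ_π = e·υ_2):
  -- "w(x) ≥ k" iff  k ≤ m  and  π^k ∣ x.
  ValGe : ℕ → Carrier → ℕ → Set (c ⊔ ℓ)
  ValGe m x k = (k ≤ m) × Divides (pow π k) x

  -- The division  x / y  in O_K/π^m does NOT raise an error,
  -- i.e. w(y) ≤ w(x)  (equivalently: for every k, w(y) ≥ k ⇒ w(x) ≥ k).
  DivOK : ℕ → Carrier → Carrier → Set (c ⊔ ℓ)
  DivOK m x y = ∀ k → ValGe m y k → ValGe m x k

  DivResult : ℕ → Carrier → Carrier → Carrier → Set (c ⊔ ℓ)
  DivResult m x y z = Cong m x (y * z) × (Cong m x 0# → Cong m z 0#)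

  -- LinDiffSolve(a, f, n):  y_0 := -f_0/(2a),
  -- y_i := (i·y_{i-1} - f_i) / (2a(2i+1)).
  -- z : Series records the values y_i computed by the algorithm.

  numer : Series → Series → ℕ → Carrier
  numer f z ℕ.zero    = - f ℕ.zero
  numer f z (suc i) = ι (suc i) * z i - f (suc i)

  denom : Carrier → ℕ → Carrier
  denom a ℕ.zero    = ι 2 * a
  denom a (suc i) = (ι 2 * a) * ι (suc (2 ℕ.* suc i))

  Step : ℕ → Carrier → Series → Series → ℕ → Set (c ⊔ ℓ)
  Step m a f z i = DivResult m (numer f z i) (denom a i) (z i)

-- e·M  where  M = N + ⌊log₂(n+1)⌋ + 1  and  N = Ne / e
precM : ℕ → ℕ → ℕ → ℕ
precM e Ne n = Ne ℕ.+ e ℕ.* (⌊log₂ (suc n) ⌋ ℕ.+ 1)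

-- Let Eᵢ = zᵢ - yᵢ be the error of the i-th computed coefficient and rᵢ the defect of
-- the i-th division, so that π^{eM} ∣ rᵢ. The recurrence defining ψ₊ gives
-- denomᵢ · Eᵢ = i · Eᵢ₋₁ - rᵢ, and denomᵢ = 2a(2i+1) is π^e times a unit: each step
-- loses e in valuation but gains υ_π(i) = e · v₂(i). Since v₂(i) = s(i-1) + 1 - s(i)
-- for the binary digit sum s, this telescopes to υ_π(Eᵢ) ≥ e(M - 1) - e·s(i), and
-- s(i) ≤ ⌊log₂(n+1)⌋ for i < n. The same bound shows that every numerator
-- i·zᵢ₋₁ - fᵢ is divisible by π^e, the exact valuation of the divisor.

module Submission where

open import Defs
open import Level using (Level; _⊔_)
open import Algebra.Bundles using (CommutativeRing)
import Algebra.Solver.Ring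
open import Algebra.Solver.Ring.AlmostCommutativeRing
  using (_-Raw-AlmostCommutative⟶_; fromCommutativeRing)
open import Data.Bool.Base using (Bool; true; false)
open import Data.Integer.Base as ℤ using (ℤ; +_; -[1+_]; _⊖_)
import Data.Integer.Properties as ℤ
open import Data.List.Base using (List; []; _∷_)
open import Data.Maybe.Base using (Maybe; just; nothing)
open import Data.Nat as ℕ using (ℕ; zero; suc; _≤_; _<_; z≤n; s≤s)
import Data.Nat.Properties as ℕ
open import Data.Nat.Induction using (<-rec)
open import Data.Nat.Logarithm using (⌊log₂_⌋; ⌊log₂⌋-mono-≤; ⌊log₂[2^n]⌋≡n)
open import Data.Nat.Tactic.RingSolver using (solve-∀)
open import Data.Product using (Σ; _×_; _,_; proj₁)
open import Data.Sign.Base as Sign using ()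
open import Data.Sum.Base using (inj₁; inj₂)
open import Relation.Binary.PropositionalEquality as ≡ using (_≡_)
open import Relation.Nullary.Decidable using (yes; no)
open import Relation.Nullary.Negation using (¬_; contradiction)

-- The library's ring solver needs a coefficient ring with decidable equality mapping
-- into R; ℤ does. The optimised multiple _×′_ makes fromℤ (+ 1) reduce to 1#, so that
-- con (+ 1) denotes 1# on the nose in solver goals.
module IntegerCoefficientSolver {c ℓ} (R : CommutativeRing c ℓ) where
  open CommutativeRing R
  open import Algebra.Properties.Ring ring
    using (-0#≈0#; -‿involutive; -‿+-comm; xyx⁻¹≈y; -‿distribˡ-*; -‿distribʳ-*)
  open import Algebra.Properties.Semiring.Mult.TCOptimised semiring
    using (1+×; ×-homo-+; ×1-homo-*) renaming (_×_ to _×′_)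
  open import Relation.Binary.Reasoning.Setoid setoid

  fromℤ : ℤ → Carrier
  fromℤ (+ n)    = n ×′ 1#
  fromℤ -[1+ n ] = - (suc n ×′ 1#)

  fromℤ-‿homo : ∀ i → fromℤ (ℤ.- i) ≈ - fromℤ i
  fromℤ-‿homo -[1+ n ]    = sym (-‿involutive _)
  fromℤ-‿homo (+ zero)    = sym -0#≈0#
  fromℤ-‿homo (+ (suc n)) = refl

  fromℤ-⊖ : ∀ m n → fromℤ (m ⊖ n) ≈ m ×′ 1# - n ×′ 1#
  fromℤ-⊖ m       zero    = sym (trans (+-congˡ -0#≈0#) (+-identityʳ _))
  fromℤ-⊖ zero    (suc n) = sym (+-identityˡ _)
  fromℤ-⊖ (suc m) (suc n) = begin
    fromℤ (suc m ⊖ suc n)             ≡⟨ ≡.cong fromℤ (ℤ.[1+m]⊖[1+n]≡m⊖n m n) ⟩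
    fromℤ (m ⊖ n)                     ≈⟨ fromℤ-⊖ m n ⟩
    m ×′ 1# - n ×′ 1#                 ≈⟨ +-congʳ (xyx⁻¹≈y 1# (m ×′ 1#)) ⟨
    1# + m ×′ 1# - 1# - n ×′ 1#       ≈⟨ +-assoc _ _ _ ⟩
    1# + m ×′ 1# + (- 1# - n ×′ 1#)   ≈⟨ +-cong (sym (1+× m 1#)) (-‿+-comm 1# (n ×′ 1#)) ⟩
    suc m ×′ 1# - (1# + n ×′ 1#)      ≈⟨ +-congˡ (-‿cong (1+× n 1#)) ⟨
    suc m ×′ 1# - suc n ×′ 1#         ∎

  fromℤ-+-homo : ∀ i j → fromℤ (i ℤ.+ j) ≈ fromℤ i + fromℤ j
  fromℤ-+-homo (+ m)    (+ n)    = ×-homo-+ 1# m n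
  fromℤ-+-homo (+ m)    -[1+ n ] = fromℤ-⊖ m (suc n)
  fromℤ-+-homo -[1+ m ] (+ n)    = trans (fromℤ-⊖ n (suc m)) (+-comm _ _)
  fromℤ-+-homo -[1+ m ] -[1+ n ] = begin
    - (suc (suc (m ℕ.+ n)) ×′ 1#)   ≡⟨ ≡.cong (λ k → - (suc k ×′ 1#)) (ℕ.+-suc m n) ⟨
    - ((suc m ℕ.+ suc n) ×′ 1#)     ≈⟨ -‿cong (×-homo-+ 1# (suc m) (suc n)) ⟩
    - (suc m ×′ 1# + suc n ×′ 1#)   ≈⟨ -‿+-comm _ _ ⟨
    - (suc m ×′ 1#) - suc n ×′ 1#   ∎

  fromℤ-*-homo : ∀ i j → fromℤ (i ℤ.* j) ≈ fromℤ i * fromℤ j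
  fromℤ-*-homo (+ m) (+ n) = begin
    fromℤ (Sign.+ ℤ.◃ m ℕ.* n)      ≡⟨ ≡.cong fromℤ (ℤ.+◃n≡+n (m ℕ.* n)) ⟩
    (m ℕ.* n) ×′ 1#                 ≈⟨ ×1-homo-* m n ⟩
    m ×′ 1# * n ×′ 1#               ∎
  fromℤ-*-homo (+ m) -[1+ n ] = begin
    fromℤ (Sign.- ℤ.◃ m ℕ.* suc n)  ≡⟨ ≡.cong fromℤ (ℤ.-◃n≡-n (m ℕ.* suc n)) ⟩
    fromℤ (ℤ.- (+ (m ℕ.* suc n)))   ≈⟨ fromℤ-‿homo (+ (m ℕ.* suc n)) ⟩
    - ((m ℕ.* suc n) ×′ 1#)         ≈⟨ -‿cong (×1-homo-* m (suc n)) ⟩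
    - (m ×′ 1# * suc n ×′ 1#)       ≈⟨ -‿distribʳ-* _ _ ⟩
    m ×′ 1# * - (suc n ×′ 1#)       ∎
  fromℤ-*-homo -[1+ m ] (+ n) = begin
    fromℤ (Sign.- ℤ.◃ suc m ℕ.* n)  ≡⟨ ≡.cong fromℤ (ℤ.-◃n≡-n (suc m ℕ.* n)) ⟩
    fromℤ (ℤ.- (+ (suc m ℕ.* n)))   ≈⟨ fromℤ-‿homo (+ (suc m ℕ.* n)) ⟩
    - ((suc m ℕ.* n) ×′ 1#)         ≈⟨ -‿cong (×1-homo-* (suc m) n) ⟩
    - (suc m ×′ 1# * n ×′ 1#)       ≈⟨ -‿distribˡ-* _ _ ⟩
    - (suc m ×′ 1#) * n ×′ 1#       ∎
  fromℤ-*-homo -[1+ m ] -[1+ n ] = begin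
    (suc m ℕ.* suc n) ×′ 1#            ≈⟨ ×1-homo-* (suc m) (suc n) ⟩
    suc m ×′ 1# * suc n ×′ 1#          ≈⟨ -‿involutive _ ⟨
    - - (suc m ×′ 1# * suc n ×′ 1#)    ≈⟨ -‿cong (-‿distribˡ-* _ _) ⟩
    - (- (suc m ×′ 1#) * suc n ×′ 1#)  ≈⟨ -‿distribʳ-* _ _ ⟩
    - (suc m ×′ 1#) * - (suc n ×′ 1#)  ∎

  homomorphism : ℤ.+-*-rawRing -Raw-AlmostCommutative⟶ fromCommutativeRing R
  homomorphism = record
    { ⟦_⟧    = fromℤ
    ; +-homo = fromℤ-+-homo
    ; *-homo = fromℤ-*-homo
    ; -‿homo = fromℤ-‿homo
    ; 0-homo = refl
    ; 1-homo = refl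
    }

  fromℤ-dec : ∀ i j → Maybe (fromℤ i ≈ fromℤ j)
  fromℤ-dec i j with i ℤ.≟ j
  ... | yes ≡.refl = just refl
  ... | no _       = nothing

  open Algebra.Solver.Ring ℤ.+-*-rawRing (fromCommutativeRing R) homomorphism fromℤ-dec public
    using (solve; _:=_; con; _:+_; _:*_; _:-_; :-_)

module Binary where
  open import Data.Nat.Base using (_+_; _*_; _^_)

  inc : List Bool → List Bool
  inc []           = true ∷ []
  inc (false ∷ bs) = true ∷ bs
  inc (true  ∷ bs) = false ∷ inc bs

  toBits : ℕ → List Bool
  toBits zero    = []
  toBits (suc n) = inc (toBits n)

  fromBits : List Bool → ℕ
  fromBits []           = 0
  fromBits (false ∷ bs) = 2 * fromBits bs
  fromBits (true  ∷ bs) = suc (2 * fromBits bs)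

  ones : List Bool → ℕ
  ones []           = 0
  ones (false ∷ bs) = ones bs
  ones (true  ∷ bs) = suc (ones bs)

  trailingOnes : List Bool → ℕ
  trailingOnes []           = 0
  trailingOnes (false ∷ _)  = 0
  trailingOnes (true  ∷ bs) = suc (trailingOnes bs)

  fromBits-inc : ∀ bs → fromBits (inc bs) ≡ suc (fromBits bs)
  fromBits-inc []           = ≡.refl
  fromBits-inc (false ∷ bs) = ≡.refl
  fromBits-inc (true  ∷ bs) = ≡.trans (≡.cong (2 *_) (fromBits-inc bs)) (ℕ.*-suc 2 (fromBits bs))

  fromBits-toBits : ∀ n → fromBits (toBits n) ≡ n
  fromBits-toBits zero    = ≡.refl
  fromBits-toBits (suc n) = ≡.trans (fromBits-inc (toBits n)) (≡.cong suc (fromBits-toBits n))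

  ones-inc : ∀ bs → ones (inc bs) + trailingOnes bs ≡ suc (ones bs)
  ones-inc []           = ≡.refl
  ones-inc (false ∷ bs) = ℕ.+-identityʳ _
  ones-inc (true  ∷ bs) = ≡.trans (ℕ.+-suc (ones (inc bs)) (trailingOnes bs)) (≡.cong suc (ones-inc bs))

  fromBits-inc≡2^trailingOnes*odd : ∀ bs → Σ ℕ λ q → fromBits (inc bs) ≡ 2 ^ trailingOnes bs * suc (2 * q)
  fromBits-inc≡2^trailingOnes*odd []           = 0 , ≡.refl
  fromBits-inc≡2^trailingOnes*odd (false ∷ bs) = fromBits bs , ≡.sym (ℕ.*-identityˡ _)
  fromBits-inc≡2^trailingOnes*odd (true  ∷ bs) with fromBits-inc≡2^trailingOnes*odd bs
  ... | q , eq = q , ≡.trans (≡.cong (2 *_) eq) (≡.sym (ℕ.*-assoc 2 (2 ^ trailingOnes bs) _))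

  2^ones≤1+fromBits : ∀ bs → 2 ^ ones bs ≤ suc (fromBits bs)
  2^ones≤1+fromBits []           = ℕ.≤-refl
  2^ones≤1+fromBits (false ∷ bs) = ℕ.≤-trans (2^ones≤1+fromBits bs) (s≤s (ℕ.m≤n*m (fromBits bs) 2))
  2^ones≤1+fromBits (true  ∷ bs) =
    ≡.subst (2 * 2 ^ ones bs ≤_) (ℕ.*-suc 2 (fromBits bs)) (ℕ.*-monoʳ-≤ 2 (2^ones≤1+fromBits bs))

  popCount : ℕ → ℕ
  popCount n = ones (toBits n)

  popCount-suc : ∀ n → popCount (suc n) + trailingOnes (toBits n) ≡ suc (popCount n)
  popCount-suc n = ones-inc (toBits n)

  suc≡2^trailingOnes*odd : ∀ n → Σ ℕ λ q → suc n ≡ 2 ^ trailingOnes (toBits n) * suc (2 * q)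
  suc≡2^trailingOnes*odd n with fromBits-inc≡2^trailingOnes*odd (toBits n)
  ... | q , eq = q , ≡.trans (≡.sym (fromBits-toBits (suc n))) eq

  popCount≤⌊log₂⌋ : ∀ {i n} → i ≤ n → popCount i ≤ ⌊log₂ suc n ⌋
  popCount≤⌊log₂⌋ {i} {n} i≤n = ≡.subst (_≤ ⌊log₂ suc n ⌋) (⌊log₂[2^n]⌋≡n (popCount i))
    (⌊log₂⌋-mono-≤ (ℕ.≤-trans 2^popCount≤1+i (s≤s i≤n)))
    where
    2^popCount≤1+i : 2 ^ popCount i ≤ suc i
    2^popCount≤1+i = ≡.subst (2 ^ popCount i ≤_) (≡.cong suc (fromBits-toBits i)) (2^ones≤1+fromBits (toBits i))

open Binary

module RingNotationProperties {c ℓ} (R : CommutativeRing c ℓ) where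
  open CommutativeRing R
  open RingNotation R
  open IntegerCoefficientSolver R
  open import Relation.Binary.Reasoning.Setoid setoid

  pow-+ : ∀ x j k → pow x (j ℕ.+ k) ≈ pow x j * pow x k
  pow-+ x zero    k = sym (*-identityˡ _)
  pow-+ x (suc j) k = trans (*-congˡ (pow-+ x j k)) (sym (*-assoc _ _ _))

  ι-+ : ∀ m n → ι (m ℕ.+ n) ≈ ι m + ι n
  ι-+ zero    n = sym (+-identityˡ _)
  ι-+ (suc m) n = trans (+-congˡ (ι-+ m n)) (sym (+-assoc _ _ _))

  ι-* : ∀ m n → ι (m ℕ.* n) ≈ ι m * ι n
  ι-* zero    n = sym (zeroˡ _)
  ι-* (suc m) n = begin
    ι (n ℕ.+ m ℕ.* n)    ≈⟨ ι-+ n (m ℕ.* n) ⟩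
    ι n + ι (m ℕ.* n)    ≈⟨ +-congˡ (ι-* m n) ⟩
    ι n + ι m * ι n      ≈⟨ solve 2 (λ x y → x :+ y :* x := (con (+ 1) :+ y) :* x) refl (ι n) (ι m) ⟩
    (1# + ι m) * ι n     ∎

  1-unit : IsUnit 1#
  1-unit = 1# , *-identityˡ 1#

  unit-* : ∀ {u v} → IsUnit u → IsUnit v → IsUnit (u * v)
  unit-* {u} {v} (u⁻¹ , uu⁻¹≈1) (v⁻¹ , vv⁻¹≈1) = u⁻¹ * v⁻¹ , (begin
    (u * v) * (u⁻¹ * v⁻¹)  ≈⟨ solve 4 (λ u v u' v' → (u :* v) :* (u' :* v') := (u :* u') :* (v :* v')) refl u v u⁻¹ v⁻¹ ⟩
    (u * u⁻¹) * (v * v⁻¹)  ≈⟨ *-cong uu⁻¹≈1 vv⁻¹≈1 ⟩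
    1# * 1#                ≈⟨ *-identityˡ 1# ⟩
    1#                     ∎)

module Valuation {c ℓ} (O : DVR₂ c ℓ) where
  open DVR₂ O
  open RingNotationProperties cring
  open IntegerCoefficientSolver cring
  open import Algebra.Properties.Ring ring using (-‿distribʳ-*; x[y-z]≈xy-xz; x∙y⁻¹≈ε⇒x≈y)
  open import Relation.Binary.Reasoning.Setoid setoid

  -- A record rather than Divides (pow π k) x, so that k is recoverable by unification.
  infix 4 π^_∣_
  record π^_∣_ (k : ℕ) (x : Carrier) : Set (c ⊔ ℓ) where
    constructor divides
    field
      quotient : Carrier
      equation : x ≈ pow π k * quotient

  fromDivides : ∀ {k x} → Divides (pow π k) x → π^ k ∣ x
  fromDivides (q , eq) = divides q eq

  toDivides : ∀ {k x} → π^ k ∣ x → Divides (pow π k) x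
  toDivides (divides q eq) = q , eq

  ∣-resp : ∀ {k x y} → x ≈ y → π^ k ∣ x → π^ k ∣ y
  ∣-resp x≈y (divides q eq) = divides q (trans (sym x≈y) eq)

  ∣0 : ∀ {k} → π^ k ∣ 0#
  ∣0 = divides 0# (sym (zeroʳ _))

  π^0∣ : ∀ x → π^ 0 ∣ x
  π^0∣ x = divides x (sym (*-identityˡ x))

  π^k∣π^k* : ∀ k w → π^ k ∣ pow π k * w
  π^k∣π^k* k w = divides w refl

  ∣-+ : ∀ {k x y} → π^ k ∣ x → π^ k ∣ y → π^ k ∣ x + y
  ∣-+ (divides p eq₁) (divides q eq₂) = divides (p + q) (trans (+-cong eq₁ eq₂) (sym (distribˡ _ _ _)))

  ∣⇒∣- : ∀ {k x} → π^ k ∣ x → π^ k ∣ - x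
  ∣⇒∣- (divides p eq) = divides (- p) (trans (-‿cong eq) (-‿distribʳ-* _ _))

  ∣-- : ∀ {k x y} → π^ k ∣ x → π^ k ∣ y → π^ k ∣ x - y
  ∣-- d₁ d₂ = ∣-+ d₁ (∣⇒∣- d₂)

  ∣-*ˡ : ∀ {k x} w → π^ k ∣ x → π^ k ∣ w * x
  ∣-*ˡ w (divides p eq) = divides (w * p) (trans (*-congˡ eq)
    (solve 3 (λ w P p → w :* (P :* p) := P :* (w :* p)) refl w _ p))

  ∣-*ʳ : ∀ {k x} w → π^ k ∣ x → π^ k ∣ x * w
  ∣-*ʳ w d = ∣-resp (*-comm w _) (∣-*ˡ w d)

  ∣-* : ∀ {j k x y} → π^ j ∣ x → π^ k ∣ y → π^ (j ℕ.+ k) ∣ x * y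
  ∣-* {j} {k} {x} {y} (divides p eq₁) (divides q eq₂) = divides (p * q) (begin
    x * y                          ≈⟨ *-cong eq₁ eq₂ ⟩
    (pow π j * p) * (pow π k * q)  ≈⟨ solve 4 (λ P p Q q → (P :* p) :* (Q :* q) := (P :* Q) :* (p :* q)) refl _ p _ q ⟩
    (pow π j * pow π k) * (p * q)  ≈⟨ *-congʳ (pow-+ π j k) ⟨
    pow π (j ℕ.+ k) * (p * q)      ∎)

  ∣-≤ : ∀ {j k x} → j ≤ k → π^ k ∣ x → π^ j ∣ x
  ∣-≤ {j} {k} {x} j≤k (divides q eq) = divides (pow π (k ℕ.∸ j) * q) (begin
    x                                  ≈⟨ eq ⟩
    pow π k * q                        ≡⟨ ≡.cong (λ t → pow π t * q) (ℕ.m+[n∸m]≡n j≤k) ⟨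
    pow π (j ℕ.+ (k ℕ.∸ j)) * q        ≈⟨ *-congʳ (pow-+ π j (k ℕ.∸ j)) ⟩
    (pow π j * pow π (k ℕ.∸ j)) * q    ≈⟨ *-assoc _ _ _ ⟩
    pow π j * (pow π (k ℕ.∸ j) * q)    ∎)

  π^k∣π^k : ∀ k → π^ k ∣ pow π k
  π^k∣π^k k = divides 1# (sym (*-identityʳ _))

  nonzero-*≈0 : ∀ {a b} → ¬ (a ≈ 0#) → a * b ≈ 0# → b ≈ 0#
  nonzero-*≈0 a≉0 ab≈0 with domain _ _ ab≈0
  ... | inj₁ a≈0 = contradiction a≈0 a≉0
  ... | inj₂ b≈0 = b≈0

  pow-π≉0 : ∀ j → ¬ (pow π j ≈ 0#)
  pow-π≉0 zero    = 1≉0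
  pow-π≉0 (suc j) = λ ππ^j≈0 → pow-π≉0 j (nonzero-*≈0 π≉0 ππ^j≈0)

  π^-cancelˡ : ∀ j {k x} → π^ (j ℕ.+ k) ∣ pow π j * x → π^ k ∣ x
  π^-cancelˡ j {k} {x} (divides q eq) = divides q (x∙y⁻¹≈ε⇒x≈y _ _ (nonzero-*≈0 (pow-π≉0 j) (begin
    pow π j * (x - pow π k * q)                      ≈⟨ x[y-z]≈xy-xz _ _ _ ⟩
    pow π j * x - pow π j * (pow π k * q)            ≈⟨ +-congˡ (-‿cong (*-assoc _ _ _)) ⟨
    pow π j * x - (pow π j * pow π k) * q            ≈⟨ +-congˡ (-‿cong (*-congʳ (pow-+ π j k))) ⟨
    pow π j * x - pow π (j ℕ.+ k) * q                ≈⟨ +-congˡ (-‿cong eq) ⟨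
    pow π j * x - pow π j * x                        ≈⟨ -‿inverseʳ _ ⟩
    0#                                               ∎)))

  unit-cancelˡ : ∀ {k w x} → IsUnit w → π^ k ∣ w * x → π^ k ∣ x
  unit-cancelˡ {w = w} {x} (v , wv≈1) d = ∣-resp (begin
    v * (w * x)   ≈⟨ solve 3 (λ v w x → v :* (w :* x) := (w :* v) :* x) refl v w x ⟩
    (w * v) * x   ≈⟨ *-congʳ wv≈1 ⟩
    1# * x        ≈⟨ *-identityˡ x ⟩
    x             ∎) (∣-*ˡ v d)

  π∤unit : ∀ {w} → IsUnit w → ¬ π^ 1 ∣ w
  π∤unit {w} (v , wv≈1) (divides q eq) = π-nonunit (q * v , (begin
    π * (q * v)          ≈⟨ solve 3 (λ π q v → π :* (q :* v) := (π :* con (+ 1) :* q) :* v) refl π q v ⟩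
    (pow π 1 * q) * v    ≈⟨ *-congʳ eq ⟨
    w * v                ≈⟨ wv≈1 ⟩
    1#                   ∎))

  π∤1+π* : ∀ X → ¬ π^ 1 ∣ 1# + π * X
  π∤1+π* X d = π∤unit 1-unit (∣-resp
    (solve 2 (λ π X → (con (+ 1) :+ π :* X) :- π :* X := con (+ 1)) refl π X)
    (∣-- d (∣-*ʳ X (∣-resp (*-identityʳ π) (π^k∣π^k 1)))))

  1+π*-unit : ∀ X → IsUnit (1# + π * X)
  1+π*-unit X with factor (1# + π * X) (λ eq → π∤1+π* X (∣-resp (sym eq) ∣0))
  ... | zero  , u , (v , uv≈1) , eq = v , trans (*-congʳ (trans eq (*-identityʳ u))) uv≈1
  ... | suc k , u , _ , eq           =
    contradiction (∣-≤ (s≤s z≤n) (∣-resp (sym eq) (∣-*ˡ u (π^k∣π^k (suc k))))) (π∤1+π* X)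

  π^*unit-bound : ∀ {j k w} → IsUnit w → π^ k ∣ pow π j * w → k ≤ j
  π^*unit-bound {j} {k} w-unit d with k ℕ.≤? j
  ... | yes k≤j = k≤j
  ... | no  k≰j = contradiction
    (π^-cancelˡ j (∣-≤ (≡.subst (_≤ k) (ℕ.+-comm 1 j) (ℕ.≰⇒> k≰j)) d)) (π∤unit w-unit)

  π^*unit-cancelˡ : ∀ {j k w x} → IsUnit w → π^ (j ℕ.+ k) ∣ (pow π j * w) * x → π^ k ∣ x
  π^*unit-cancelˡ {j} w-unit d = unit-cancelˡ w-unit (π^-cancelˡ j (∣-resp (*-assoc _ _ _) d))

  π^e∣2 : π^ e ∣ ι 2
  π^e∣2 with two
  ... | u , _ , eq = divides u (trans eq (*-comm u _))

  ι-odd≈1+π* : ∀ q → Σ Carrier λ X → ι (suc (2 ℕ.* q)) ≈ 1# + π * X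
  ι-odd≈1+π* q with ∣-≤ e≥1 π^e∣2
  ... | divides d eq = d * ι q , +-congˡ (begin
    ι (2 ℕ.* q)             ≈⟨ ι-* 2 q ⟩
    ι 2 * ι q               ≈⟨ *-congʳ eq ⟩
    (π * 1# * d) * ι q      ≈⟨ solve 3 (λ π d i → (π :* con (+ 1) :* d) :* i := π :* (d :* i)) refl π d (ι q) ⟩
    π * (d * ι q)           ∎)

  π^e*c∣ι[2^c] : ∀ c → π^ (e ℕ.* c) ∣ ι (2 ℕ.^ c)
  π^e*c∣ι[2^c] zero    = ≡.subst (π^_∣ ι 1) (≡.sym (ℕ.*-zeroʳ e)) (π^0∣ _)
  π^e*c∣ι[2^c] (suc c) = ≡.subst (π^_∣ ι (2 ℕ.^ suc c)) (≡.sym (ℕ.*-suc e c))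
    (∣-resp (sym (ι-* 2 (2 ℕ.^ c))) (∣-* π^e∣2 (π^e*c∣ι[2^c] c)))

  π^∣ι-suc : ∀ n → π^ (e ℕ.* trailingOnes (toBits n)) ∣ ι (suc n)
  π^∣ι-suc n with suc≡2^trailingOnes*odd n
  ... | q , eq = ≡.subst (λ m → π^ e ℕ.* t ∣ ι m) (≡.sym eq)
    (∣-resp (sym (ι-* (2 ℕ.^ t) (suc (2 ℕ.* q)))) (∣-*ʳ (ι (suc (2 ℕ.* q))) (π^e*c∣ι[2^c] t)))
    where
    t : ℕ
    t = trailingOnes (toBits n)

  π^∣π^popCount-suc* : ∀ {B} i x → π^ B ∣ pow π (e ℕ.* popCount i) * x →
                       π^ (e ℕ.+ B) ∣ pow π (e ℕ.* popCount (suc i)) * (ι (suc i) * x)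
  π^∣π^popCount-suc* i x d with π^∣ι-suc i
  ... | divides Y ι≈ = ∣-resp (sym (begin
    P′ * (ι (suc i) * x)      ≈⟨ *-congˡ (*-congʳ ι≈) ⟩
    P′ * ((Q * Y) * x)        ≈⟨ solve 4 (λ P′ Q Y x → P′ :* ((Q :* Y) :* x) := (P′ :* Q) :* (Y :* x)) refl P′ Q Y x ⟩
    (P′ * Q) * (Y * x)        ≈⟨ *-congʳ P′Q≈π^eP ⟩
    (pow π e * P) * (Y * x)   ≈⟨ solve 4 (λ E P Y x → (E :* P) :* (Y :* x) := E :* (Y :* (P :* x))) refl _ P Y x ⟩
    pow π e * (Y * (P * x))   ∎)) (∣-* (π^k∣π^k e) (∣-*ˡ Y d))
    where
    t : ℕ
    t = trailingOnes (toBits i)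
    P P′ Q : Carrier
    P  = pow π (e ℕ.* popCount i)
    P′ = pow π (e ℕ.* popCount (suc i))
    Q  = pow π (e ℕ.* t)
    exponents : e ℕ.* popCount (suc i) ℕ.+ e ℕ.* t ≡ e ℕ.+ e ℕ.* popCount i
    exponents = ≡.trans (≡.sym (ℕ.*-distribˡ-+ e (popCount (suc i)) t))
                (≡.trans (≡.cong (e ℕ.*_) (popCount-suc i)) (ℕ.*-suc e (popCount i)))
    P′Q≈π^eP : P′ * Q ≈ pow π e * P
    P′Q≈π^eP = begin
      P′ * Q                                          ≈⟨ pow-+ π (e ℕ.* popCount (suc i)) (e ℕ.* t) ⟨
      pow π (e ℕ.* popCount (suc i) ℕ.+ e ℕ.* t)     ≡⟨ ≡.cong (pow π) exponents ⟩
      pow π (e ℕ.+ e ℕ.* popCount i)                 ≈⟨ pow-+ π e _ ⟩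
      pow π e * P                                     ∎

precM≡e+[Ne+e*⌊log₂⌋] : ∀ e Ne n → precM e Ne n ≡ e ℕ.+ (Ne ℕ.+ e ℕ.* ⌊log₂ suc n ⌋)
precM≡e+[Ne+e*⌊log₂⌋] e Ne n = rearrange e Ne ⌊log₂ suc n ⌋
  where
  rearrange : ∀ e Ne L → Ne ℕ.+ e ℕ.* (L ℕ.+ 1) ≡ e ℕ.+ (Ne ℕ.+ e ℕ.* L)
  rearrange = solve-∀

module LinDiffSolve {c ℓ} (O : DVR₂ c ℓ) (a : DVR₂.Carrier O) (a-unit : DVR₂.IsUnit O a) where
  open DVR₂ O
  open OnDVR O
  open RingNotationProperties cring
  open IntegerCoefficientSolver cring
  open Valuation O
  open import Algebra.Properties.Ring ring using (-‿involutive; x[y-z]≈xy-xz)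
  open import Relation.Binary.Reasoning.Setoid setoid

  denom≈π^e*unit : ∀ i → Σ Carrier λ w → IsUnit w × denom a i ≈ pow π e * w
  denom≈π^e*unit zero with two
  ... | u , u-unit , 2≈uπ^e = u * a , unit-* u-unit a-unit , (begin
    ι 2 * a              ≈⟨ *-congʳ 2≈uπ^e ⟩
    (u * pow π e) * a    ≈⟨ solve 3 (λ u P a → (u :* P) :* a := P :* (u :* a)) refl u _ a ⟩
    pow π e * (u * a)    ∎)
  denom≈π^e*unit (suc i) with denom≈π^e*unit 0 | ι-odd≈1+π* (suc i)
  ... | w , w-unit , 2a≈π^ew | X , odd≈1+πX = w * (1# + π * X) , unit-* w-unit (1+π*-unit X) ,
    trans (*-cong 2a≈π^ew odd≈1+πX) (*-assoc _ _ _)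

  π^e∣denom : ∀ i → π^ e ∣ denom a i
  π^e∣denom i with denom≈π^e*unit i
  ... | w , _ , eq = ∣-resp (sym eq) (π^k∣π^k* e w)

  denom-cancel : ∀ i {k x} → π^ (e ℕ.+ k) ∣ denom a i * x → π^ k ∣ x
  denom-cancel i d with denom≈π^e*unit i
  ... | w , w-unit , eq = π^*unit-cancelˡ w-unit (∣-resp (*-congʳ eq) d)

  denom-bound : ∀ i {k} → π^ k ∣ denom a i → k ≤ e
  denom-bound i d with denom≈π^e*unit i
  ... | w , w-unit , eq = π^*unit-bound w-unit (∣-resp eq d)

  Lop-zero : ∀ y → Lop a y 0 ≈ - (denom a 0 * y 0)
  Lop-zero y = solve 2 (λ D Y → con (+ 0) :+ (con (+ 0) :- D :* Y) := :- (D :* Y)) refl (denom a 0) (y 0)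

  mulT-deriv : ∀ y j → mulT (deriv y) j ≈ ι j * y j
  mulT-deriv y zero    = sym (zeroˡ _)
  mulT-deriv y (suc j) = refl

  Lop-suc : ∀ y j → Lop a y (suc j) ≈ ι (suc j) * y j - denom a (suc j) * y (suc j)
  Lop-suc y j = begin
    (mulT (deriv y) j - (ι 4 * a) * (ι (suc j) * y (suc j))) + (y j - (ι 2 * a) * y (suc j))
      ≈⟨ +-congʳ (+-cong (mulT-deriv y j) (-‿cong (*-congʳ (*-congʳ (ι-* 2 2))))) ⟩
    (ι j * y j - ((ι 2 * ι 2) * a) * ((1# + ι j) * y (suc j))) + (y j - (ι 2 * a) * y (suc j))
      ≈⟨ solve 5 (λ I T A Y Y′ →
           (I :* Y :- (T :* T :* A) :* ((con (+ 1) :+ I) :* Y′)) :+ (Y :- (T :* A) :* Y′)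
           := (con (+ 1) :+ I) :* Y :- (T :* A) :* (con (+ 1) :+ T :* (con (+ 1) :+ I)) :* Y′)
           refl (ι j) (ι 2) a (y j) (y (suc j)) ⟩
    (1# + ι j) * y j - ((ι 2 * a) * (1# + ι 2 * (1# + ι j))) * y (suc j)
      ≈⟨ +-congˡ (-‿cong (*-congʳ (*-congˡ (+-congˡ (ι-* 2 (suc j)))))) ⟨
    ι (suc j) * y j - denom a (suc j) * y (suc j)
      ∎

  module Run (n Ne : ℕ) (f y : Series) (ψ : IsPsi a n f y) (z : Series) where
    B : ℕ
    B = Ne ℕ.+ e ℕ.* ⌊log₂ suc n ⌋

    residual : ℕ → Carrier
    residual i = numer f z i - denom a i * z i

    propagated : ℕ → Carrier
    propagated zero    = 0#
    propagated (suc j) = ι (suc j) * (z j - y j)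

    -- υ(zᵢ - yᵢ) ≥ B - e·popCount i, multiplied out to avoid truncated subtraction.
    ErrorBound : ℕ → Set (c ⊔ ℓ)
    ErrorBound i = π^ B ∣ pow π (e ℕ.* popCount i) * (z i - y i)

    e*popCount≤e*⌊log₂⌋ : ∀ {i} → i < n → e ℕ.* popCount i ≤ e ℕ.* ⌊log₂ suc n ⌋
    e*popCount≤e*⌊log₂⌋ i<n = ℕ.*-monoʳ-≤ e (popCount≤⌊log₂⌋ (ℕ.<⇒≤ i<n))

    numer≈propagated+denom*y : ∀ i → i < n → numer f z i ≈ propagated i + denom a i * y i
    numer≈propagated+denom*y zero    0<n = begin
      - f 0                    ≈⟨ -‿cong (trans (sym (ψ 0 0<n)) (Lop-zero y)) ⟩
      - - (denom a 0 * y 0)    ≈⟨ -‿involutive _ ⟩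
      denom a 0 * y 0          ≈⟨ +-identityˡ _ ⟨
      0# + denom a 0 * y 0     ∎
    numer≈propagated+denom*y (suc j) j<n = begin
      ι (suc j) * z j - f (suc j)
        ≈⟨ +-congˡ (-‿cong (trans (sym (ψ (suc j) j<n)) (Lop-suc y j))) ⟩
      ι (suc j) * z j - (ι (suc j) * y j - denom a (suc j) * y (suc j))
        ≈⟨ solve 5 (λ J Z Y D Y′ → J :* Z :- (J :* Y :- D :* Y′) := J :* (Z :- Y) :+ D :* Y′)
             refl (ι (suc j)) (z j) (y j) (denom a (suc j)) (y (suc j)) ⟩
      ι (suc j) * (z j - y j) + denom a (suc j) * y (suc j)
        ∎

    denom*error≈propagated-residual : ∀ i → i < n → denom a i * (z i - y i) ≈ propagated i - residual i
    denom*error≈propagated-residual i i<n = begin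
      denom a i * (z i - y i)
        ≈⟨ solve 4 (λ D Z Y P → D :* (Z :- Y) := P :- ((P :+ D :* Y) :- D :* Z))
             refl (denom a i) (z i) (y i) (propagated i) ⟩
      propagated i - ((propagated i + denom a i * y i) - denom a i * z i)
        ≈⟨ +-congˡ (-‿cong (+-congʳ (numer≈propagated+denom*y i i<n))) ⟨
      propagated i - residual i
        ∎

    propagated-bound : ∀ i → (∀ {j} → j < i → ErrorBound j) →
                       π^ (e ℕ.+ B) ∣ pow π (e ℕ.* popCount i) * propagated i
    propagated-bound zero    _      = ∣-*ˡ _ ∣0
    propagated-bound (suc j) bounds = π^∣π^popCount-suc* j (z j - y j) (bounds ℕ.≤-refl)

    error-bound-step : ∀ i → i < n → (∀ {j} → j < i → ErrorBound j) →
                       π^ (e ℕ.+ B) ∣ residual i → ErrorBound i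
    error-bound-step i i<n bounds π^∣residual = denom-cancel i (∣-resp (begin
      P * propagated i - P * residual i    ≈⟨ x[y-z]≈xy-xz _ _ _ ⟨
      P * (propagated i - residual i)      ≈⟨ *-congˡ (denom*error≈propagated-residual i i<n) ⟨
      P * (denom a i * (z i - y i))        ≈⟨ solve 3 (λ P D E → P :* (D :* E) := D :* (P :* E)) refl P (denom a i) _ ⟩
      denom a i * (P * (z i - y i))        ∎)
      (∣-- (propagated-bound i bounds) (∣-*ˡ P π^∣residual)))
      where
      P : Carrier
      P = pow π (e ℕ.* popCount i)

    error-bound : ∀ i → i < n → (∀ j → j ≤ i → π^ (e ℕ.+ B) ∣ residual j) → ErrorBound i
    error-bound = <-rec _ λ i earlier i<n residuals → error-bound-step i i<n
      (λ j<i → earlier j<i (ℕ.<-trans j<i i<n) (λ k k≤j → residuals k (ℕ.≤-trans k≤j (ℕ.<⇒≤ j<i))))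
      (residuals i ℕ.≤-refl)

    step-residual : ∀ {j} → Step (precM e Ne n) a f z j → π^ (e ℕ.+ B) ∣ residual j
    step-residual {j} st = ≡.subst (π^_∣ residual j) (precM≡e+[Ne+e*⌊log₂⌋] e Ne n) (fromDivides (proj₁ st))

    π^e∣numer : ∀ i → i < n → (∀ j → j < i → Step (precM e Ne n) a f z j) → π^ e ∣ numer f z i
    π^e∣numer i i<n steps = ∣-resp (sym (numer≈propagated+denom*y i i<n))
      (∣-+ (π^-cancelˡ (e ℕ.* popCount i) (∣-≤ e*popCount+e≤e+B (propagated-bound i bounds)))
           (∣-*ʳ (y i) (π^e∣denom i)))
      where
      bounds : ∀ {j} → j < i → ErrorBound j
      bounds {j} j<i = error-bound j (ℕ.<-trans j<i i<n) (λ k k≤j → step-residual (steps k (ℕ.≤-<-trans k≤j j<i)))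
      e*popCount+e≤e+B : e ℕ.* popCount i ℕ.+ e ≤ e ℕ.+ B
      e*popCount+e≤e+B = ≡.subst (_≤ e ℕ.+ B) (ℕ.+-comm e _)
        (ℕ.+-monoʳ-≤ e (ℕ.≤-trans (e*popCount≤e*⌊log₂⌋ i<n) (ℕ.m≤n+m _ Ne)))

    z≈y-mod-π^Ne : (∀ j → j < n → Step (precM e Ne n) a f z j) → ∀ i → i < n → π^ Ne ∣ z i - y i
    z≈y-mod-π^Ne steps i i<n = π^-cancelˡ (e ℕ.* popCount i)
      (∣-≤ e*popCount+Ne≤B (error-bound i i<n (λ j j≤i → step-residual (steps j (ℕ.≤-<-trans j≤i i<n)))))
      where
      e*popCount+Ne≤B : e ℕ.* popCount i ℕ.+ Ne ≤ B
      e*popCount+Ne≤B = ≡.subst (_≤ B) (ℕ.+-comm Ne _) (ℕ.+-monoʳ-≤ Ne (e*popCount≤e*⌊log₂⌋ i<n))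

proposition2p6 :
  ∀ {c ℓ : Level} (O : DVR₂ c ℓ) →
  let open DVR₂ O
      open OnDVR O
  in
  (a : Carrier) → IsUnit a →
  (n Ne : ℕ) →
  (f : Series) →
  (y : Series) → IsPsi a n f y →
  -- no division raises an error, for every legal run
  (∀ (z : Series) (i : ℕ) → i < n →
     (∀ j → j < i → Step (precM e Ne n) a f z j) →
     DivOK (precM e Ne n) (numer f z i) (denom a i))
  ×
  -- every legal run returns ψ_{+,n}(f) modulo (π^{eN}, t^n)
  (∀ (z : Series) →
     (∀ j → j < n → Step (precM e Ne n) a f z j) →
     ∀ i → i < n → Cong Ne (z i) (y i))
proposition2p6 O a a-unit n Ne f y ψ =
  (λ z i i<n steps k (k≤m , π^k∣denom) →
     k≤m , toDivides (∣-≤ (denom-bound i (fromDivides {k} π^k∣denom)) (Run.π^e∣numer n Ne f y ψ z i i<n steps))) ,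
  (λ z steps i i<n → toDivides (Run.z≈y-mod-π^Ne n Ne f y ψ z steps i i<n))
  where
  open Valuation O
  open LinDiffSolve O a a-unit
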